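{- Let $w\in S_n$. Then $$\prod_{i=1}^n (c_i(w)+1)\le rk(w),$$ with equality if and only if $w$ avoids the pattern $312$.
   Context: Permutations are written in one-line notation $w=w_1\cdots w_n$. The Lehmer code is $c(w)=(c_1(w),\ldots,c_n(w))$ with $c_i(w)=\#\{j: i<j\le n,\ w_j<w_i\}$. The south-west diagram of $w$ is $O_w=\{(i,w_j): 1\le i<j\le n,\ w_i<w_j\}\subseteq[n]\times[n]$. $rk(w)$ is the number of ways to place $n$ rooks on the cells of $([n]\times[n])\setminus O_w$ such that no two rooks lie in the same row or the same column. $w$ avoids $312$ if there are no $a<b<c$ with $w_b<w_c<w_a$. -}

module Defs where

open import Data.Nat using (ℕ; zero; suc)
open import Data.Fin using (Fin; zero; suc; _<_)
open import Data.Fin.Properties using (_≟_; _<?_; any?; all?)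
open import Data.Fin.Permutation using (Permutation′; _⟨$⟩ʳ_)
open import Data.List using (List; []; _∷_; [_]; map; concatMap; length; filter; allFin)
open import Data.Nat.ListAction using (product)
open import Data.Product using (Σ; ∃; _×_; _,_)
open import Relation.Nullary using (¬_; Dec)
open import Relation.Nullary.Decidable using (_×-dec_; ¬?; _→-dec_)
open import Relation.Binary.PropositionalEquality using (_≡_)

lehmer : ∀ {n} → Permutation′ n → Fin n → ℕ
lehmer {n} w i = length (filter (λ j → (i <? j) ×-dec ((w ⟨$⟩ʳ j) <? (w ⟨$⟩ʳ i))) (allFin n))

lehmerProduct : ∀ {n} → Permutation′ n → ℕ
lehmerProduct {n} w = product (map (λ i → suc (lehmer w i)) (allFin n))

InO : ∀ {n} → Permutation′ n → Fin n → Fin n → Set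
InO w r c = ∃ λ j → (r < j) × ((w ⟨$⟩ʳ r) < (w ⟨$⟩ʳ j)) × ((w ⟨$⟩ʳ j) ≡ c)

InO? : ∀ {n} (w : Permutation′ n) (r c : Fin n) → Dec (InO w r c)
InO? w r c = any? (λ j → (r <? j) ×-dec (((w ⟨$⟩ʳ r) <? (w ⟨$⟩ʳ j)) ×-dec ((w ⟨$⟩ʳ j) ≟ c)))

allFuns : (n m : ℕ) → List (Fin n → Fin m)
allFuns zero    m = [ (λ ()) ]
allFuns (suc n) m = concatMap (λ f → map (λ x → cons x f) (allFin m)) (allFuns n m)
  where
  cons : Fin m → (Fin n → Fin m) → Fin (suc n) → Fin m
  cons x f zero    = x
  cons x f (suc i) = f i

-- a placement of n rooks on [n]×[n] \ O_w, no two in a common row or column: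
-- rook in row i sits in column f i (one rook per row); columns pairwise distinct;
-- no rook on a cell of O_w.
IsRookPlacement : ∀ {n} → Permutation′ n → (Fin n → Fin n) → Set
IsRookPlacement w f =
  (∀ i → ∀ j → f i ≡ f j → i ≡ j) × (∀ i → ¬ InO w i (f i))

IsRookPlacement? : ∀ {n} (w : Permutation′ n) (f : Fin n → Fin n) → Dec (IsRookPlacement w f)
IsRookPlacement? w f =
  all? (λ i → all? (λ j → (f i ≟ f j) →-dec (i ≟ j)))
  ×-dec all? (λ i → ¬? (InO? w i (f i)))

rk : ∀ {n} → Permutation′ n → ℕ
rk {n} w = length (filter (IsRookPlacement? w) (allFuns n n))

Avoids312 : ∀ {n} → Permutation′ n → Set
Avoids312 {n} w = ¬ (Σ (Fin n) λ a → Σ (Fin n) λ b → Σ (Fin n) λ c →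
  (a < b) × (b < c) × ((w ⟨$⟩ʳ b) < (w ⟨$⟩ʳ c)) × ((w ⟨$⟩ʳ c) < (w ⟨$⟩ʳ a)))

module Submission where

open import Defs
open import Data.Nat using (ℕ; _≤_)
open import Data.Fin.Permutation using (Permutation′)
open import Data.Product using (_×_)
open import Function.Bundles using (_⇔_)
open import Relation.Binary.PropositionalEquality using (_≡_)

-- The statement is an instance of a general fact about
-- rook placements on a board B with n rows, whose i-th row (counted from 0)
-- has r_i allowed cells.  Placing the rook of row 0 first and recursing on
-- the minor (delete row 0 and the chosen column) shows
--   (1) ∏ᵢ (r_i ∸ i) ≤ #placements(B)                       (bound≤rooks),
--   (2) equality holds when the rows are nested, i.e. a cell allowed in
--       row k is allowed in every later row                (rooks≡bound),
--   (3) the inequality is strict when r_i > i for all i and some column is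
--       allowed in a row k but forbidden in a later row i  (bound<rooks).
-- For a permutation w, the complement of the diagram O_w is such a board;
-- reindexing columns by w shows r_i = i + 1 + c_i(w), so the bound is the
-- Lehmer product.  A 312-pattern a < b < c gives the column w_c, allowed in
-- row a but not in row b, while avoiding 312 makes the rows nested.

open import Data.Nat using (zero; suc; _+_; _*_; _∸_; _<_; z≤n; s≤s; s≤s⁻¹; >-nonZero)
open import Data.Nat.Properties
open import Data.Nat.ListAction using (product) renaming (sum to listSum)
open import Data.Nat.ListAction.Properties using (sum-++)
open import Data.Fin as Fin using (Fin; zero; suc; toℕ; punchIn)
import Data.Fin.Properties as Finₚ
open import Data.Fin.Permutation using (_⟨$⟩ʳ_; _⟨$⟩ˡ_; inverseˡ)
import Data.Vec.Functional as Vector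
open import Data.List using (List; []; _∷_; _++_; map; concatMap; length; filter; allFin; tabulate)
import Data.List.Properties as Listₚ
open import Data.Product using (Σ; ∃; _,_; proj₁; proj₂)
open import Data.Empty using (⊥-elim)
open import Function.Base using (_∘_; id)
open import Function.Bundles using (mk⇔; Equivalence)
open import Function.Properties.Equivalence using () renaming (trans to ⇔-trans)
open import Relation.Nullary using (¬_; Dec; yes; no; contradiction)
open import Relation.Nullary.Decidable using (_×-dec_; ¬?; _→-dec_)
open import Relation.Unary using (Decidable)
open import Relation.Binary using (tri<; tri≈; tri>)
open import Relation.Binary.PropositionalEquality
  using (refl; sym; trans; cong; cong₂; subst; subst₂; _≢_; _≗_; module ≡-Reasoning)
open import Algebra.Properties.Semiring.Sum +-*-semiring
  using (sum; sum-syntax; sum-cong-≗; sum-remove; sum-permute; ∑-distrib-+; *-distribʳ-sum; sum-replicate-zero)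
import Algebra.Properties.Monoid.Sum *-1-monoid as Product

𝟙 : ∀ {p} {P : Set p} → Dec P → ℕ
𝟙 (yes _) = 1
𝟙 (no _)  = 0

module _ {p} {P : Set p} where

  𝟙-yes : (d : Dec P) → P → 𝟙 d ≡ 1
  𝟙-yes (yes _) _  = refl
  𝟙-yes (no ¬p) p  = contradiction p ¬p

  𝟙-no : (d : Dec P) → ¬ P → 𝟙 d ≡ 0
  𝟙-no (yes p) ¬p = contradiction p ¬p
  𝟙-no (no _)  _  = refl

  𝟙≤1 : (d : Dec P) → 𝟙 d ≤ 1
  𝟙≤1 (yes _) = ≤-refl
  𝟙≤1 (no _)  = z≤n

  𝟙*-cong : ∀ {a b} (d : Dec P) → (P → a ≡ b) → 𝟙 d * a ≡ 𝟙 d * b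
  𝟙*-cong (yes p) a≡b = cong (1 *_) (a≡b p)
  𝟙*-cong (no _)  _   = refl

  𝟙*-< : ∀ {a b} (d : Dec P) → P → a < b → 𝟙 d * a < 𝟙 d * b
  𝟙*-< (yes _) _ a<b = *-monoʳ-< 1 a<b
  𝟙*-< (no ¬p) p _   = contradiction p ¬p

  𝟙-× : ∀ {q} {Q : Set q} (d : Dec P) (e : Dec Q) → 𝟙 (d ×-dec e) ≡ 𝟙 d * 𝟙 e
  𝟙-× (yes _) (yes _) = refl
  𝟙-× (yes _) (no _)  = refl
  𝟙-× (no _)  _       = refl

𝟙-cong : ∀ {p q} {P : Set p} {Q : Set q} → P ⇔ Q → (d : Dec P) (e : Dec Q) → 𝟙 d ≡ 𝟙 e
𝟙-cong P⇔Q (yes p) e = sym (𝟙-yes e (Equivalence.to P⇔Q p))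
𝟙-cong P⇔Q (no ¬p) e = sym (𝟙-no e (¬p ∘ Equivalence.from P⇔Q))

count : ∀ {m} {P : Fin m → Set} → Decidable P → ℕ
count {m} P? = ∑[ c < m ] 𝟙 (P? c)

count-witness : ∀ {m} {P : Fin m → Set} (P? : Decidable P) → 0 < count P? → ∃ P
count-witness {suc m} P? pos with P? zero
... | yes p = zero , p
... | no _  with x , px ← count-witness (P? ∘ suc) pos = suc x , px

count-remove : ∀ {m} {P : Fin m → Set} (P? : Decidable P) (x : Fin m) →
  count P? ≡ 𝟙 (P? x) + count (λ c → P? c ×-dec ¬? (c Finₚ.≟ x))
count-remove {suc m} {P} P? x = begin
  count P?                                    ≡⟨ sum-remove {i = x} (𝟙 ∘ P?) ⟩
  𝟙 (P? x) + ∑[ j < m ] 𝟙 (P? (punchIn x j))  ≡⟨ cong (𝟙 (P? x) +_) (sum-cong-≗ λ j →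
                                                   𝟙-cong (mk⇔ (_, Finₚ.punchInᵢ≢i x j) proj₁) (P? (punchIn x j)) (Q? (punchIn x j))) ⟩
  𝟙 (P? x) + ∑[ j < m ] 𝟙 (Q? (punchIn x j))  ≡⟨ cong (𝟙 (P? x) +_) (sym (trans (sum-remove {i = x} (𝟙 ∘ Q?))
                                                   (cong (λ k → k + ∑[ j < m ] 𝟙 (Q? (punchIn x j))) (𝟙-no (Q? x) λ (_ , x≢x) → x≢x refl)))) ⟩
  𝟙 (P? x) + count Q?                         ∎
  where
  open ≡-Reasoning
  Q? : Decidable (λ c → P c × c ≢ x)
  Q? c = P? c ×-dec ¬? (c Finₚ.≟ x)

count-≤ : ∀ {n} (i : Fin n) → count (λ (j : Fin n) → j Finₚ.≤? i) ≡ suc (toℕ i)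
count-≤ {suc n} zero = cong suc (begin
  ∑[ j < n ] 𝟙 (suc j Finₚ.≤? zero {n})  ≡⟨ sum-cong-≗ {n} {y = λ _ → 0} (λ j → 𝟙-no (suc j Finₚ.≤? zero {n}) λ ()) ⟩
  ∑[ j < n ] 0                           ≡⟨ sum-replicate-zero n ⟩
  0                                      ∎)
  where open ≡-Reasoning
count-≤ {suc n} (suc i) = cong suc (begin
  ∑[ j < n ] 𝟙 (suc j Finₚ.≤? suc i)  ≡⟨ sum-cong-≗ {n} {x = λ j → 𝟙 (suc j Finₚ.≤? suc i)} (λ j → 𝟙-cong (mk⇔ s≤s⁻¹ s≤s) (suc j Finₚ.≤? suc i) (j Finₚ.≤? i)) ⟩
  ∑[ j < n ] 𝟙 (j Finₚ.≤? i)          ≡⟨ count-≤ i ⟩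
  suc (toℕ i)                         ∎)
  where open ≡-Reasoning

∑-mono-≤ : ∀ {n} {f g : Fin n → ℕ} → (∀ x → f x ≤ g x) → sum f ≤ sum g
∑-mono-≤ {zero}  _   = z≤n
∑-mono-≤ {suc n} f≤g = +-mono-≤ (f≤g zero) (∑-mono-≤ (f≤g ∘ suc))

∑-mono-< : ∀ {n} {f g : Fin n → ℕ} → (∀ x → f x ≤ g x) → ∀ y → f y < g y → sum f < sum g
∑-mono-< f≤g zero    fy<gy = +-mono-<-≤ fy<gy (∑-mono-≤ (f≤g ∘ suc))
∑-mono-< f≤g (suc y) fy<gy = +-mono-≤-< (f≤g zero) (∑-mono-< (f≤g ∘ suc) y fy<gy)

∏ : ∀ {n} → (Fin n → ℕ) → ℕ
∏ = Product.sum

∏-mono-≤ : ∀ {n} {f g : Fin n → ℕ} → (∀ x → f x ≤ g x) → ∏ f ≤ ∏ g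
∏-mono-≤ {zero}  _   = ≤-refl
∏-mono-≤ {suc n} f≤g = *-mono-≤ (f≤g zero) (∏-mono-≤ (f≤g ∘ suc))

∏-pos : ∀ {n} {f : Fin n → ℕ} → (∀ x → 0 < f x) → 0 < ∏ f
∏-pos {zero}  _   = ≤-refl
∏-pos {suc n} pos = *-mono-≤ (pos zero) (∏-pos (pos ∘ suc))

∏-mono-< : ∀ {n} {f g : Fin n → ℕ} → (∀ x → 0 < f x) → (∀ x → f x ≤ g x) →
  ∀ y → f y < g y → ∏ f < ∏ g
∏-mono-< {f = f} {g} pos f≤g zero fy<gy = begin-strict
  f zero * ∏ (f ∘ suc) <⟨ *-monoˡ-< (∏ (f ∘ suc)) {{>-nonZero (∏-pos (pos ∘ suc))}} fy<gy ⟩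
  g zero * ∏ (f ∘ suc) ≤⟨ *-monoʳ-≤ (g zero) (∏-mono-≤ (f≤g ∘ suc)) ⟩
  g zero * ∏ (g ∘ suc) ∎
  where open ≤-Reasoning
∏-mono-< {f = f} {g} pos f≤g (suc y) fy<gy = begin-strict
  f zero * ∏ (f ∘ suc) <⟨ *-monoʳ-< (f zero) {{>-nonZero (pos zero)}} (∏-mono-< (pos ∘ suc) (f≤g ∘ suc) y fy<gy) ⟩
  f zero * ∏ (g ∘ suc) ≤⟨ *-monoˡ-≤ (∏ (g ∘ suc)) (f≤g zero) ⟩
  g zero * ∏ (g ∘ suc) ∎
  where open ≤-Reasoning

Σ-list : ∀ {a} {X : Set a} → (X → ℕ) → List X → ℕ
Σ-list h xs = listSum (map h xs)

module _ {a} {X : Set a} where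

  length-filter : ∀ {p} {P : X → Set p} (P? : Decidable P) xs → length (filter P? xs) ≡ Σ-list (𝟙 ∘ P?) xs
  length-filter P? []       = refl
  length-filter P? (x ∷ xs) with P? x
  ... | yes _ = cong suc (length-filter P? xs)
  ... | no _  = length-filter P? xs

  Σ-list-cong : ∀ {h h′ : X → ℕ} → h ≗ h′ → ∀ xs → Σ-list h xs ≡ Σ-list h′ xs
  Σ-list-cong h≗h′ xs = cong listSum (Listₚ.map-cong h≗h′ xs)

  Σ-list-concatMap : ∀ {b} {Y : Set b} (h : Y → ℕ) (k : X → List Y) xs →
    Σ-list h (concatMap k xs) ≡ Σ-list (Σ-list h ∘ k) xs
  Σ-list-concatMap h k []       = refl
  Σ-list-concatMap h k (x ∷ xs) = begin
    listSum (map h (k x ++ concatMap k xs))          ≡⟨ cong listSum (Listₚ.map-++ h (k x) _) ⟩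
    listSum (map h (k x) ++ map h (concatMap k xs))  ≡⟨ sum-++ (map h (k x)) _ ⟩
    Σ-list h (k x) + Σ-list h (concatMap k xs)       ≡⟨ cong (Σ-list h (k x) +_) (Σ-list-concatMap h k xs) ⟩
    Σ-list (Σ-list h ∘ k) (x ∷ xs)                   ∎
    where open ≡-Reasoning

  Σ-list-*ˡ : ∀ c (h : X → ℕ) xs → Σ-list (λ x → c * h x) xs ≡ c * Σ-list h xs
  Σ-list-*ˡ c h []       = sym (*-zeroʳ c)
  Σ-list-*ˡ c h (x ∷ xs) = trans (cong (c * h x +_) (Σ-list-*ˡ c h xs)) (sym (*-distribˡ-+ c (h x) _))

  Σ-list-∑-comm : ∀ {m} (g : Fin m → X → ℕ) xs →
    Σ-list (λ x → ∑[ c < m ] g c x) xs ≡ ∑[ c < m ] Σ-list (g c) xs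
  Σ-list-∑-comm {m} g []       = sym (sum-replicate-zero m)
  Σ-list-∑-comm     g (x ∷ xs) = trans (cong (sum (λ c → g c x) +_) (Σ-list-∑-comm g xs))
                                       (sym (∑-distrib-+ (λ c → g c x) (λ c → Σ-list (g c) xs)))

Σ-list-tabulate : ∀ {m} (h : Fin m → ℕ) → Σ-list h (allFin m) ≡ sum h
Σ-list-tabulate h = trans (cong listSum (Listₚ.map-tabulate id h)) (listSum-tabulate h)
  where
  listSum-tabulate : ∀ {k} (t : Fin k → ℕ) → listSum (tabulate t) ≡ sum t
  listSum-tabulate {zero}  t = refl
  listSum-tabulate {suc k} t = cong (t zero +_) (listSum-tabulate (t ∘ suc))

product-tabulate : ∀ {m} (h : Fin m → ℕ) → product (map h (allFin m)) ≡ ∏ h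
product-tabulate h = trans (cong product (Listₚ.map-tabulate id h)) (product-tabulate′ h)
  where
  product-tabulate′ : ∀ {k} (t : Fin k → ℕ) → product (tabulate t) ≡ ∏ t
  product-tabulate′ {zero}  t = refl
  product-tabulate′ {suc k} t = cong (t zero *_) (product-tabulate′ (t ∘ suc))

Σ-list-map-allFin : ∀ {b} {Y : Set b} {m} (h : Y → ℕ) (g : Fin m → Y) → Σ-list h (map g (allFin m)) ≡ sum (h ∘ g)
Σ-list-map-allFin {m = m} h g = trans (cong listSum (sym (Listₚ.map-∘ {g = h} {f = g} (allFin m)))) (Σ-list-tabulate (h ∘ g))

length-filter-allFin : ∀ {m} {P : Fin m → Set} (P? : Decidable P) → length (filter P? (allFin m)) ≡ count P?
length-filter-allFin P? = trans (length-filter P? (allFin _)) (Σ-list-tabulate (𝟙 ∘ P?))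

record Board (n m : ℕ) : Set₁ where
  field
    Allowed  : Fin n → Fin m → Set
    allowed? : ∀ i c → Dec (Allowed i c)
open Board

Placement : ∀ {n m} → Board n m → (Fin n → Fin m) → Set
Placement B f = (∀ i j → f i ≡ f j → i ≡ j) × (∀ i → Allowed B i (f i))

placement? : ∀ {n m} (B : Board n m) → Decidable (Placement B)
placement? B f = Finₚ.all? (λ i → Finₚ.all? λ j → (f i Finₚ.≟ f j) →-dec (i Finₚ.≟ j))
                 ×-dec Finₚ.all? (λ i → allowed? B i (f i))

placement-resp : ∀ {n m} (B : Board n m) {f g : Fin n → Fin m} → f ≗ g → Placement B f → Placement B g
placement-resp B f≗g (injective , allowed) =
  (λ i j gi≡gj → injective i j (trans (f≗g i) (trans gi≡gj (sym (f≗g j))))) ,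
  (λ i → subst (Allowed B i) (f≗g i) (allowed i))

minor : ∀ {n m} → Board (suc n) m → Fin m → Board n m
minor B x = record
  { Allowed  = λ i c → Allowed B (suc i) c × c ≢ x
  ; allowed? = λ i c → allowed? B (suc i) c ×-dec ¬? (c Finₚ.≟ x)
  }

placement-uncons : ∀ {n m} (B : Board (suc n) m) (x : Fin m) (f : Fin n → Fin m) →
  Placement B (x Vector.∷ f) ⇔ (Allowed B zero x × Placement (minor B x) f)
placement-uncons B x f = mk⇔ to from
  where
  to : Placement B (x Vector.∷ f) → Allowed B zero x × Placement (minor B x) f
  to (injective , allowed) =
    allowed zero ,
    (λ i j fi≡fj → Finₚ.suc-injective (injective (suc i) (suc j) fi≡fj)) ,
    (λ i → allowed (suc i) , λ fi≡x → Finₚ.0≢1+n (sym (injective (suc i) zero fi≡x)))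
  from : Allowed B zero x × Placement (minor B x) f → Placement B (x Vector.∷ f)
  from (allowed₀ , injective , allowed) = injective′ , allowed′
    where
    injective′ : ∀ i j → (x Vector.∷ f) i ≡ (x Vector.∷ f) j → i ≡ j
    injective′ zero    zero    _ = refl
    injective′ zero    (suc j) e = ⊥-elim (proj₂ (allowed j) (sym e))
    injective′ (suc i) zero    e = ⊥-elim (proj₂ (allowed i) e)
    injective′ (suc i) (suc j) e = cong suc (injective i j e)
    allowed′ : ∀ i → Allowed B i ((x Vector.∷ f) i)
    allowed′ zero    = allowed₀
    allowed′ (suc i) = proj₁ (allowed i)

-- The number of placements, by choice of the column of the first rook.
rooks : ∀ {n m} → Board n m → ℕ
rooks {zero}      B = 1
rooks {suc n} {m} B = ∑[ x < m ] (𝟙 (allowed? B zero x) * rooks (minor B x))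

count-extensions : ∀ {n m} (B : Board (suc n) m) (V? : Decidable (Placement B))
  (ext : Fin m → (Fin n → Fin m) → Fin (suc n) → Fin m) → (∀ x f → ext x f ≗ x Vector.∷ f) →
  (L : List (Fin n → Fin m)) →
  length (filter V? (concatMap (λ f → map (λ x → ext x f) (allFin m)) L))
    ≡ ∑[ x < m ] (𝟙 (allowed? B zero x) * length (filter (placement? (minor B x)) L))
count-extensions {n} {m} B V? ext ext≗∷ L = begin
  length (filter V? (concatMap extensions L))
    ≡⟨ length-filter V? (concatMap extensions L) ⟩
  Σ-list (𝟙 ∘ V?) (concatMap extensions L)
    ≡⟨ Σ-list-concatMap (𝟙 ∘ V?) extensions L ⟩
  Σ-list (λ f → Σ-list (𝟙 ∘ V?) (extensions f)) L
    ≡⟨ Σ-list-cong (λ f → trans (Σ-list-map-allFin (𝟙 ∘ V?) (λ x → ext x f)) (sum-cong-≗ (split f))) L ⟩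
  Σ-list (λ f → ∑[ x < m ] (𝟙 (allowed? B zero x) * 𝟙 (placement? (minor B x) f))) L
    ≡⟨ Σ-list-∑-comm (λ x f → 𝟙 (allowed? B zero x) * 𝟙 (placement? (minor B x) f)) L ⟩
  ∑[ x < m ] Σ-list (λ f → 𝟙 (allowed? B zero x) * 𝟙 (placement? (minor B x) f)) L
    ≡⟨ sum-cong-≗ (λ x → trans (Σ-list-*ˡ (𝟙 (allowed? B zero x)) _ L)
                                (cong (𝟙 (allowed? B zero x) *_) (sym (length-filter _ L)))) ⟩
  ∑[ x < m ] (𝟙 (allowed? B zero x) * length (filter (placement? (minor B x)) L)) ∎
  where
  open ≡-Reasoning
  extensions : (Fin n → Fin m) → List (Fin (suc n) → Fin m)
  extensions f = map (λ x → ext x f) (allFin m)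
  split : ∀ f x → 𝟙 (V? (ext x f)) ≡ 𝟙 (allowed? B zero x) * 𝟙 (placement? (minor B x) f)
  split f x = trans
    (𝟙-cong (⇔-trans (mk⇔ (placement-resp B (ext≗∷ x f)) (placement-resp B (sym ∘ ext≗∷ x f)))
                     (placement-uncons B x f))
            (V? (ext x f)) (allowed? B zero x ×-dec placement? (minor B x) f))
    (𝟙-× (allowed? B zero x) (placement? (minor B x) f))

count-placements : ∀ {n m} (B : Board n m) (V? : Decidable (Placement B)) →
  length (filter V? (allFuns n m)) ≡ rooks B
count-placements {zero}  B V? = trans (length-filter V? (allFuns zero _)) (cong (_+ 0) (𝟙-yes (V? _) ((λ ()) , (λ ()))))
count-placements {suc n} B V? =
  trans (count-extensions B V? _ (λ { x f zero → refl ; x f (suc i) → refl }) (allFuns n _))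
        (sum-cong-≗ λ x → cong (𝟙 (allowed? B zero x) *_) (count-placements (minor B x) _))

rowSize : ∀ {n m} → Board n m → Fin n → ℕ
rowSize B i = count (allowed? B i)

bound : ∀ {n m} → Board n m → ℕ
bound B = ∏ (λ i → rowSize B i ∸ toℕ i)

tailBound : ∀ {n m} → Board (suc n) m → ℕ
tailBound B = ∏ (λ i → rowSize B (suc i) ∸ suc (toℕ i))

-- bound B = rowSize B zero * tailBound B, written as a sum over the first row.
bound-unfold : ∀ {n m} (B : Board (suc n) m) → bound B ≡ ∑[ x < m ] (𝟙 (allowed? B zero x) * tailBound B)
bound-unfold B = *-distribʳ-sum (tailBound B) (𝟙 ∘ allowed? B zero)

rowSize-minor : ∀ {n m} (B : Board (suc n) m) x i →
  rowSize B (suc i) ≡ 𝟙 (allowed? B (suc i) x) + rowSize (minor B x) i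
rowSize-minor B x i = count-remove (allowed? B (suc i)) x

rowSize-minor-≤ : ∀ {n m} (B : Board (suc n) m) x i → rowSize B (suc i) ≤ suc (rowSize (minor B x) i)
rowSize-minor-≤ B x i = ≤-trans (≤-reflexive (rowSize-minor B x i)) (+-monoˡ-≤ _ (𝟙≤1 (allowed? B (suc i) x)))

tailBound≤bound-minor : ∀ {n m} (B : Board (suc n) m) x → tailBound B ≤ bound (minor B x)
tailBound≤bound-minor B x = ∏-mono-≤ λ i → ∸-monoˡ-≤ (suc (toℕ i)) (rowSize-minor-≤ B x i)

bound≤rooks : ∀ {n m} (B : Board n m) → bound B ≤ rooks B
bound≤rooks {zero}      B = ≤-refl
bound≤rooks {suc n} {m} B = begin
  bound B                                             ≡⟨ bound-unfold B ⟩
  ∑[ x < m ] (𝟙 (allowed? B zero x) * tailBound B)   ≤⟨ ∑-mono-≤ (λ x → *-monoʳ-≤ (𝟙 (allowed? B zero x))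
                                                           (minor-bound x)) ⟩
  rooks B                                             ∎
  where
  open ≤-Reasoning
  minor-bound : ∀ x → tailBound B ≤ rooks (minor B x)
  minor-bound x = ≤-trans (tailBound≤bound-minor B x) (bound≤rooks (minor B x))

Nested : ∀ {n m} → Board n m → Set
Nested B = ∀ {k i} → k Fin.< i → ∀ {c} → Allowed B k c → Allowed B i c

nested-minor : ∀ {n m} (B : Board (suc n) m) x → Nested B → Nested (minor B x)
nested-minor B x nested k<i (allowed , c≢x) = nested (s≤s k<i) allowed , c≢x

-- For nested rows, a column allowed in row 0 is removed from every later row.
bound-minor-nested : ∀ {n m} (B : Board (suc n) m) x → Nested B → Allowed B zero x → bound (minor B x) ≡ tailBound B
bound-minor-nested B x nested allowed₀ = Product.sum-cong-≗ λ i →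
  cong (_∸ suc (toℕ i)) (sym (trans (rowSize-minor B x i)
    (cong (_+ rowSize (minor B x) i) (𝟙-yes (allowed? B (suc i) x) (nested (s≤s z≤n) allowed₀)))))

rooks≡bound : ∀ {n m} (B : Board n m) → Nested B → rooks B ≡ bound B
rooks≡bound {zero}  B nested = refl
rooks≡bound {suc n} B nested = trans (sum-cong-≗ λ x → 𝟙*-cong (allowed? B zero x) (minor-rooks x)) (sym (bound-unfold B))
  where
  minor-rooks : ∀ x → Allowed B zero x → rooks (minor B x) ≡ tailBound B
  minor-rooks x allowed₀ = trans (rooks≡bound (minor B x) (nested-minor B x nested)) (bound-minor-nested B x nested allowed₀)

-- Row i has more than i allowed cells, for every i; then every factor of bound B is positive.
Ample : ∀ {n m} → Board n m → Set
Ample B = ∀ i → toℕ i < rowSize B i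

ample-minor : ∀ {n m} (B : Board (suc n) m) x → Ample B → Ample (minor B x)
ample-minor B x ample i = s≤s⁻¹ (≤-trans (ample (suc i)) (rowSize-minor-≤ B x i))

-- If x is forbidden in some later row, that row keeps its size in the minor, so the minor's bound is larger.
tailBound<bound-minor : ∀ {n m} (B : Board (suc n) m) → Ample B →
  ∀ x i → ¬ Allowed B (suc i) x → tailBound B < bound (minor B x)
tailBound<bound-minor B ample x i forbidden =
  ∏-mono-< (λ t → m<n⇒0<n∸m (ample (suc t))) (λ t → ∸-monoˡ-≤ (suc (toℕ t)) (rowSize-minor-≤ B x t)) i
    (subst (λ r → rowSize B (suc i) ∸ suc (toℕ i) < r ∸ toℕ i) rowSize-kept
      (∸-monoʳ-< (n<1+n (toℕ i)) (<⇒≤ (ample (suc i)))))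
  where
  rowSize-kept : rowSize B (suc i) ≡ rowSize (minor B x) i
  rowSize-kept = trans (rowSize-minor B x i) (cong (_+ rowSize (minor B x) i) (𝟙-no (allowed? B (suc i) x) forbidden))

bound<rooks-at : ∀ {n m} (B : Board (suc n) m) x → Allowed B zero x → tailBound B < rooks (minor B x) → bound B < rooks B
bound<rooks-at {m = m} B x allowed₀ lt = begin-strict
  bound B                                            ≡⟨ bound-unfold B ⟩
  ∑[ c < m ] (𝟙 (allowed? B zero c) * tailBound B)  <⟨ ∑-mono-< (λ c → *-monoʳ-≤ (𝟙 (allowed? B zero c))
                                                          (≤-trans (tailBound≤bound-minor B c) (bound≤rooks (minor B c))))
                                                          x (𝟙*-< (allowed? B zero x) allowed₀ lt) ⟩
  rooks B                                            ∎
  where open ≤-Reasoning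

bound<rooks-first : ∀ {n m} (B : Board (suc n) m) → Ample B →
  ∀ {y} i → Allowed B zero y → ¬ Allowed B (suc i) y → bound B < rooks B
bound<rooks-first B ample {y} i allowed₀ forbidden = bound<rooks-at B y allowed₀
  (<-≤-trans (tailBound<bound-minor B ample y i forbidden) (bound≤rooks (minor B y)))

-- By induction on k: put the first rook in some allowed column x (row 0 is nonempty);
-- if x = y the first-row case applies, otherwise column y still witnesses
-- non-nestedness in the minor at x, at rows k - 1 < i - 1.
bound<rooks : ∀ {n m} (B : Board n m) → Ample B → ∀ {k i} → k Fin.< i →
  ∀ {y} → Allowed B k y → ¬ Allowed B i y → bound B < rooks B
bound<rooks {suc n} B ample {zero}  {suc i} _   allowed₀ forbidden = bound<rooks-first B ample i allowed₀ forbidden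
bound<rooks {suc n} B ample {suc k} {suc i} k<i {y} allowedₖ forbidden
  with x , allowed₀ ← count-witness (allowed? B zero) (ample zero) | x Finₚ.≟ y
... | yes refl = bound<rooks-first B ample i allowed₀ forbidden
... | no x≢y   = bound<rooks-at B x allowed₀ (≤-<-trans (tailBound≤bound-minor B x)
                   (bound<rooks (minor B x) (ample-minor B x ample) (s≤s⁻¹ k<i) (allowedₖ , x≢y ∘ sym) (forbidden ∘ proj₁)))

module _ {n} (w : Permutation′ n) where

  w-injective : ∀ {j j′} → w ⟨$⟩ʳ j ≡ w ⟨$⟩ʳ j′ → j ≡ j′
  w-injective {j} {j′} e = trans (sym (inverseˡ w)) (trans (cong (w ⟨$⟩ˡ_) e) (inverseˡ w))

  InO-image : ∀ i j → InO w i (w ⟨$⟩ʳ j) ⇔ (i Fin.< j × w ⟨$⟩ʳ i Fin.< w ⟨$⟩ʳ j)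
  InO-image i j = mk⇔
    (λ { (j′ , i<j′ , wi<wj′ , wj′≡wj) → subst (λ k → i Fin.< k × w ⟨$⟩ʳ i Fin.< w ⟨$⟩ʳ k)
                                                (w-injective wj′≡wj) (i<j′ , wi<wj′) })
    (λ (i<j , wi<wj) → j , i<j , wi<wj , refl)

  board : Board n n
  board = record { Allowed = λ i c → ¬ InO w i c ; allowed? = λ i c → ¬? (InO? w i c) }

  rk≡rooks : rk w ≡ rooks board
  rk≡rooks = count-placements board (IsRookPlacement? w)

  outside-image : ∀ i j → 𝟙 (allowed? board i (w ⟨$⟩ʳ j))
    ≡ 𝟙 (j Finₚ.≤? i) + 𝟙 ((i Finₚ.<? j) ×-dec (w ⟨$⟩ʳ j Finₚ.<? w ⟨$⟩ʳ i))
  outside-image i j with j Finₚ.≤? i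
  ... | yes j≤i = trans (𝟙-yes (allowed? board i (w ⟨$⟩ʳ j)) λ o → <⇒≱ (proj₁ (Equivalence.to (InO-image i j) o)) j≤i)
                        (cong suc (sym (𝟙-no ((i Finₚ.<? j) ×-dec _) λ (i<j , _) → <⇒≱ i<j j≤i)))
  ... | no j≰i with Finₚ.<-cmp (w ⟨$⟩ʳ j) (w ⟨$⟩ʳ i)
  ...   | tri< wj<wi _ _ = trans (𝟙-yes (allowed? board i (w ⟨$⟩ʳ j)) λ o → <-asym wj<wi (proj₂ (Equivalence.to (InO-image i j) o)))
                                 (sym (𝟙-yes ((i Finₚ.<? j) ×-dec _) (≰⇒> j≰i , wj<wi)))
  ...   | tri≈ _ wj≡wi _ = contradiction (≤-reflexive (cong toℕ (w-injective wj≡wi))) j≰i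
  ...   | tri> _ _ wi<wj = trans (𝟙-no (allowed? board i (w ⟨$⟩ʳ j)) λ outside → outside (Equivalence.from (InO-image i j) (≰⇒> j≰i , wi<wj)))
                                 (sym (𝟙-no ((i Finₚ.<? j) ×-dec _) λ (_ , wj<wi) → <-asym wj<wi wi<wj))

  -- Row i of the board has i + 1 + c_i(w) cells: reindex the columns by w.
  rowSize-board : ∀ i → rowSize board i ≡ suc (toℕ i) + lehmer w i
  rowSize-board i = begin
    rowSize board i                                                ≡⟨ sum-permute (𝟙 ∘ allowed? board i) w ⟩
    ∑[ j < n ] 𝟙 (allowed? board i (w ⟨$⟩ʳ j))                     ≡⟨ sum-cong-≗ (outside-image i) ⟩
    ∑[ j < n ] (𝟙 (j Finₚ.≤? i) + 𝟙 (inversion? j))                ≡⟨ ∑-distrib-+ (λ j → 𝟙 (j Finₚ.≤? i)) (𝟙 ∘ inversion?) ⟩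
    count (λ (j : Fin n) → j Finₚ.≤? i) + count inversion?          ≡⟨ cong₂ _+_ (count-≤ i) (sym (length-filter-allFin inversion?)) ⟩
    suc (toℕ i) + lehmer w i                                        ∎
    where
    open ≡-Reasoning
    inversion? : Decidable (λ j → i Fin.< j × w ⟨$⟩ʳ j Fin.< w ⟨$⟩ʳ i)
    inversion? j = (i Finₚ.<? j) ×-dec (w ⟨$⟩ʳ j Finₚ.<? w ⟨$⟩ʳ i)

  lehmerProduct≡bound : lehmerProduct w ≡ bound board
  lehmerProduct≡bound = trans (product-tabulate (λ i → suc (lehmer w i))) (Product.sum-cong-≗ λ i → sym (begin
    rowSize board i ∸ toℕ i               ≡⟨ cong (_∸ toℕ i) (trans (rowSize-board i) (sym (+-suc (toℕ i) (lehmer w i)))) ⟩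
    toℕ i + suc (lehmer w i) ∸ toℕ i      ≡⟨ m+n∸m≡n (toℕ i) (suc (lehmer w i)) ⟩
    suc (lehmer w i)                      ∎))
    where open ≡-Reasoning

  ample : Ample board
  ample i = ≤-trans (s≤s (m≤m+n (toℕ i) (lehmer w i))) (≤-reflexive (sym (rowSize-board i)))

  -- Avoiding 312 makes the rows nested: if (k, c) is outside O_w, (i, c) ∈ O_w with
  -- witness j and k < i, then w_j < w_k would be a 312-pattern k < i < j.
  nested : Avoids312 w → Nested board
  nested avoids {k} {i} k<i outsideₖ (j , i<j , wi<wj , wj≡c) = outsideₖ (j , <-trans k<i i<j , wk<wj , wj≡c)
    where
    wk<wj : w ⟨$⟩ʳ k Fin.< w ⟨$⟩ʳ j
    wk<wj with Finₚ.<-cmp (w ⟨$⟩ʳ k) (w ⟨$⟩ʳ j)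
    ... | tri< wk<wj _ _ = wk<wj
    ... | tri≈ _ wk≡wj _ = contradiction (w-injective wk≡wj) (Finₚ.<⇒≢ (<-trans k<i i<j))
    ... | tri> _ _ wj<wk = contradiction (k , i , j , k<i , i<j , wi<wj , wj<wk) avoids

  Contains312 : Set
  Contains312 = Σ (Fin n) λ a → Σ (Fin n) λ b → Σ (Fin n) λ c →
    (a Fin.< b) × (b Fin.< c) × (w ⟨$⟩ʳ b Fin.< w ⟨$⟩ʳ c) × (w ⟨$⟩ʳ c Fin.< w ⟨$⟩ʳ a)

  -- In a 312-pattern a < b < c, the column w_c is allowed in row a but not in row b.
  pattern⇒bound<rooks : Contains312 → bound board < rooks board
  pattern⇒bound<rooks (a , b , c , a<b , b<c , wb<wc , wc<wa) = bound<rooks board ample a<b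
    (λ o → <-asym wc<wa (proj₂ (Equivalence.to (InO-image a c) o)))
    (λ outside → outside (Equivalence.from (InO-image b c) (b<c , wb<wc)))

proposition1p4 : (n : ℕ) (w : Permutation′ n) →
    (lehmerProduct w ≤ rk w) × ((lehmerProduct w ≡ rk w) ⇔ Avoids312 w)
proposition1p4 n w =
  subst₂ _≤_ (sym lehmer≡bound) (sym rk≡) (bound≤rooks (board w)) ,
  mk⇔ (λ equal occurrence → <⇒≢ (pattern⇒bound<rooks w occurrence) (trans (sym lehmer≡bound) (trans equal rk≡)))
      (λ avoids → trans lehmer≡bound (trans (sym (rooks≡bound (board w) (nested w avoids))) (sym rk≡)))
  where
  lehmer≡bound : lehmerProduct w ≡ bound (board w)
  lehmer≡bound = lehmerProduct≡bound w
  rk≡ : rk w ≡ rooks (board w)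
  rk≡ = rk≡rooks w
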